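{- Let $d\ge1$ and $d+1\le r\le 2d$ be integers. There exist constants $C>0$ and $n_0$ (depending only on $d$ and $r$) such that for all integers $n\ge n_0$, $$\overleftarrow{m}_{mon}(\mathbb{T}_n^d,r)\ \le\ 2\Big(1-\frac{d}{r}\Big)n^d+Cn^{d-1}.$$
   Context: The $d$-dimensional torus $\mathbb{T}_n^d$ is the graph with vertex set $[n]^d=\{1,\dots,n\}^d$, where two vertices are adjacent iff they differ in exactly one coordinate $j$ and in that coordinate $x_j-x'_j\equiv\pm1\pmod n$. A configuration assigns each vertex a state active (1) or inactive (0); its size is the number of active vertices. Reversible $r$-bootstrap percolation: in each round $t\ge1$, simultaneously, every vertex becomes active if it has at least $r$ active neighbors in round $t-1$ and inactive otherwise. A dynamo is an initial configuration $\omega^{(0)}$ such that from some time on all vertices are active forever; it is monotone if moreover $\omega^{(t+1)}\ge\omega^{(t)}$ coordinatewise for all $t\ge0$ (no active vertex ever becomes inactive). $\overleftarrow{m}_{mon}(G,r)$ denotes the minimum size of a monotone dynamo under reversible $r$-bootstrap percolation on $G$. -}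

module Defs where

open import Data.Nat using (ℕ; zero; suc; _+_; _≤_; _≤ᵇ_; _≡ᵇ_)
open import Data.Product using (Σ; _×_)
open import Relation.Binary.PropositionalEquality using (_≡_)
open import Data.Bool using (Bool; true; false; _∧_; _∨_; not; if_then_else_)
open import Data.Fin using (Fin; toℕ)
open import Data.Vec using (Vec; []; _∷_)
open import Data.List using (List; []; _∷_; map; concatMap; allFin)

Vertex : ℕ → ℕ → Set
Vertex d n = Vec (Fin n) d

allVertices : (d n : ℕ) → List (Vertex d n)
allVertices zero    n = [] ∷ []
allVertices (suc d) n = concatMap (λ a → map (a ∷_) (allVertices d n)) (allFin n)

eqFin : {n : ℕ} → Fin n → Fin n → Bool
eqFin a b = toℕ a ≡ᵇ toℕ b

-- a ≠ b and a - b ≡ ±1 (mod n)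
cycAdj : {n : ℕ} → Fin n → Fin n → Bool
cycAdj {n} a b =
  not (eqFin a b) ∧
  ( (suc (toℕ a) ≡ᵇ toℕ b) ∨ (suc (toℕ b) ≡ᵇ toℕ a)
  ∨ ((suc (toℕ a) ≡ᵇ n) ∧ (toℕ b ≡ᵇ 0))
  ∨ ((suc (toℕ b) ≡ᵇ n) ∧ (toℕ a ≡ᵇ 0)) )

eqVertex : {d n : ℕ} → Vertex d n → Vertex d n → Bool
eqVertex []      []      = true
eqVertex (a ∷ x) (b ∷ y) = eqFin a b ∧ eqVertex x y

adjacent : {d n : ℕ} → Vertex d n → Vertex d n → Bool
adjacent []      []      = false
adjacent (a ∷ x) (b ∷ y) = (eqFin a b ∧ adjacent x y) ∨ (cycAdj a b ∧ eqVertex x y)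

-- Configurations: true = active, false = inactive.
Config : ℕ → ℕ → Set
Config d n = Vertex d n → Bool

countList : {A : Set} → (A → Bool) → List A → ℕ
countList p []       = 0
countList p (x ∷ xs) = (if p x then 1 else 0) + countList p xs

size : {d n : ℕ} → Config d n → ℕ
size {d} {n} ω = countList ω (allVertices d n)

activeNeighbours : {d n : ℕ} → Config d n → Vertex d n → ℕ
activeNeighbours {d} {n} ω x = countList (λ y → adjacent x y ∧ ω y) (allVertices d n)

step : {d n : ℕ} → ℕ → Config d n → Config d n
step r ω x = r ≤ᵇ activeNeighbours ω x

evolve : {d n : ℕ} → ℕ → Config d n → ℕ → Config d n
evolve r ω zero    = ω
evolve r ω (suc t) = step r (evolve r ω t)

IsDynamo : {d n : ℕ} → ℕ → Config d n → Set
IsDynamo {d} {n} r ω =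
  Σ ℕ (λ T → (t : ℕ) → T ≤ t → (x : Vertex d n) → evolve r ω t x ≡ true)

IsMonotone : {d n : ℕ} → ℕ → Config d n → Set
IsMonotone {d} {n} r ω =
  (t : ℕ) → (x : Vertex d n) → evolve r ω t x ≡ true → evolve r ω (suc t) x ≡ true

IsMonotoneDynamo : {d n : ℕ} → ℕ → Config d n → Set
IsMonotoneDynamo r ω = IsDynamo r ω × IsMonotone r ω

-- Write n = m + 1 ≥ 3 and r = 1 + b + c with c ∈ {b, b + 1}, and let k = r - d. Give the last b
-- coordinates the weights b, …, 1 and the other j = c + 1 - k coordinates weight 0; the colour of a
-- vertex is its weighted coordinate sum, and a colour is marked when its residue mod r lies in
-- [0, k) ∪ [c, c + k). Start from the boundary (some coordinate 0 or m) together with the marked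
-- vertices: about (2k/r) n^d + O(n^(d-1)) of them. Away from the boundary the 2d neighbours of x have
-- colours colour x ± weights, so a marked vertex has exactly r marked neighbours, and an unmarked one has
-- at least k marked neighbours among its d "forward" ones; a boundary vertex has 2d - 1 ≥ r boundary
-- neighbours. Scheduling an inactive vertex at time 1 + (coordinate sum), its d backward neighbours
-- come earlier, so every vertex has r earlier neighbours and the process is a monotone dynamo.
-- For r = 2d the all-active configuration already meets the bound.

module Submission where

open import Defs
open import Data.Nat using (ℕ; zero; suc; pred; _+_; _*_; _∸_; _^_; _≤_; _<_; _≡ᵇ_; _≤ᵇ_; _<ᵇ_; z≤n; s≤s; s≤s⁻¹; >-nonZero)
open import Data.Nat.Properties
open import Data.Nat.DivMod
open import Data.Nat.Tactic.RingSolver using (solve-∀)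
open import Data.Product using (Σ; _×_; _,_; proj₁; proj₂; map₂)
open import Data.Sum using (_⊎_; inj₁; inj₂)
open import Data.Bool using (Bool; true; false; _∧_; _∨_; if_then_else_; T)
open import Data.Bool.Properties using (T-≡; ∧-zeroʳ)
open import Data.Fin using (Fin; toℕ; zero; suc; fromℕ; fromℕ<; inject₁)
open import Data.Fin.Properties using (toℕ-fromℕ; toℕ-fromℕ<; toℕ-inject₁; toℕ<n)
open import Data.Vec using ([]; _∷_)
open import Data.List using (List; []; _∷_; map; concatMap; tabulate; _++_)
open import Data.Empty using (⊥-elim)
open import Function using (_∘_; id)
open import Function.Bundles using (Equivalence)
open import Relation.Nullary using (¬_; yes; no; contradiction)
open import Relation.Binary.PropositionalEquality

indicator : Bool → ℕ
indicator b = if b then 1 else 0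

indicator-mono : ∀ {a b} → (a ≡ true → b ≡ true) → indicator a ≤ indicator b
indicator-mono {false} _ = z≤n
indicator-mono {true}  f rewrite f refl = ≤-refl

indicator-∨ : ∀ a b → indicator (a ∨ b) ≤ indicator a + indicator b
indicator-∨ true  _ = s≤s z≤n
indicator-∨ false _ = ≤-refl

bool-cases : ∀ b → b ≡ true ⊎ b ≡ false
bool-cases true  = inj₁ refl
bool-cases false = inj₂ refl

∧-true : ∀ {a b} → a ≡ true → b ≡ true → a ∧ b ≡ true
∧-true refl refl = refl

∧-trueˡ : ∀ a {b} → a ∧ b ≡ true → a ≡ true
∧-trueˡ true _ = refl

∧-trueʳ : ∀ a {b} → a ∧ b ≡ true → b ≡ true
∧-trueʳ true e = e

∨-trueˡ : ∀ {a} b → a ≡ true → a ∨ b ≡ true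
∨-trueˡ _ refl = refl

∨-trueʳ : ∀ a {b} → b ≡ true → a ∨ b ≡ true
∨-trueʳ true  _ = refl
∨-trueʳ false e = e

∨-true-cases : ∀ a {b} → a ∨ b ≡ true → a ≡ true ⊎ b ≡ true
∨-true-cases true  _ = inj₁ refl
∨-true-cases false e = inj₂ e

∨-false : ∀ a {b} → a ∨ b ≡ false → a ≡ false × b ≡ false
∨-false false e = refl , e

T⇒≡true : ∀ {b} → T b → b ≡ true
T⇒≡true = Equivalence.to T-≡

≡true⇒T : ∀ {b} → b ≡ true → T b
≡true⇒T = Equivalence.from T-≡

false-by-contradiction : ∀ {b} {P : Set} → (T b → P) → ¬ P → b ≡ false
false-by-contradiction {false} _ _  = refl
false-by-contradiction {true}  f ¬p = ⊥-elim (¬p (f _))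

≡ᵇ-true : ∀ {m n} → m ≡ n → (m ≡ᵇ n) ≡ true
≡ᵇ-true {m} {n} = T⇒≡true ∘ ≡⇒≡ᵇ m n

≡ᵇ-false : ∀ {m n} → m ≢ n → (m ≡ᵇ n) ≡ false
≡ᵇ-false {m} {n} = false-by-contradiction (≡ᵇ⇒≡ m n)

≡ᵇ-sound : ∀ {m n} → (m ≡ᵇ n) ≡ true → m ≡ n
≡ᵇ-sound {m} {n} = ≡ᵇ⇒≡ m n ∘ ≡true⇒T

≤ᵇ-true : ∀ {m n} → m ≤ n → (m ≤ᵇ n) ≡ true
≤ᵇ-true = T⇒≡true ∘ ≤⇒≤ᵇ

≤ᵇ-false : ∀ {m n} → n < m → (m ≤ᵇ n) ≡ false
≤ᵇ-false {m} {n} n<m = false-by-contradiction (≤ᵇ⇒≤ m n) (<⇒≱ n<m)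

≤ᵇ-sound : ∀ {m n} → (m ≤ᵇ n) ≡ true → m ≤ n
≤ᵇ-sound {m} {n} = ≤ᵇ⇒≤ m n ∘ ≡true⇒T

<ᵇ-true : ∀ {m n} → m < n → (m <ᵇ n) ≡ true
<ᵇ-true = T⇒≡true ∘ <⇒<ᵇ

<ᵇ-false : ∀ {m n} → n ≤ m → (m <ᵇ n) ≡ false
<ᵇ-false {m} {n} n≤m = false-by-contradiction (<ᵇ⇒< m n) (≤⇒≯ n≤m)

<ᵇ-sound : ∀ {m n} → (m <ᵇ n) ≡ true → m < n
<ᵇ-sound {m} {n} = <ᵇ⇒< m n ∘ ≡true⇒T

sumFin : (n : ℕ) → (Fin n → ℕ) → ℕ
sumFin zero    f = 0
sumFin (suc n) f = f zero + sumFin n (f ∘ suc)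

sumFin-cong : ∀ n {f g : Fin n → ℕ} → (∀ i → f i ≡ g i) → sumFin n f ≡ sumFin n g
sumFin-cong zero    e = refl
sumFin-cong (suc n) e = cong₂ _+_ (e zero) (sumFin-cong n (e ∘ suc))

sumFin-mono : ∀ n {f g : Fin n → ℕ} → (∀ i → f i ≤ g i) → sumFin n f ≤ sumFin n g
sumFin-mono zero    le = z≤n
sumFin-mono (suc n) le = +-mono-≤ (le zero) (sumFin-mono n (le ∘ suc))

sumFin-const : ∀ n K → sumFin n (λ _ → K) ≡ n * K
sumFin-const zero    K = refl
sumFin-const (suc n) K = cong (K +_) (sumFin-const n K)

sumFin-+ : ∀ n (f g : Fin n → ℕ) → sumFin n (λ i → f i + g i) ≡ sumFin n f + sumFin n g
sumFin-+ zero    f g = refl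
sumFin-+ (suc n) f g = trans (cong (f zero + g zero +_) (sumFin-+ n (f ∘ suc) (g ∘ suc)))
                             (interchange (f zero) (g zero) _ _)
  where
  interchange : ∀ a b c d → a + b + (c + d) ≡ a + c + (b + d)
  interchange = solve-∀

sumFin-*ˡ : ∀ n K (f : Fin n → ℕ) → K * sumFin n f ≡ sumFin n (λ i → K * f i)
sumFin-*ˡ zero    K f = *-zeroʳ K
sumFin-*ˡ (suc n) K f = trans (*-distribˡ-+ K (f zero) _) (cong (K * f zero +_) (sumFin-*ˡ n K (f ∘ suc)))

term≤sumFin : ∀ n (f : Fin n → ℕ) i → f i ≤ sumFin n f
term≤sumFin (suc n) f zero    = m≤m+n _ _
term≤sumFin (suc n) f (suc i) = ≤-trans (term≤sumFin n (f ∘ suc) i) (m≤n+m _ _)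

two-terms≤sumFin : ∀ n (f : Fin n → ℕ) {i j} → i ≢ j → f i + f j ≤ sumFin n f
two-terms≤sumFin (suc n) f {zero}  {zero}  i≢j = ⊥-elim (i≢j refl)
two-terms≤sumFin (suc n) f {zero}  {suc j} _   = +-monoʳ-≤ (f zero) (term≤sumFin n (f ∘ suc) j)
two-terms≤sumFin (suc n) f {suc i} {zero}  _   =
  ≤-trans (≤-reflexive (+-comm (f (suc i)) _)) (+-monoʳ-≤ (f zero) (term≤sumFin n (f ∘ suc) i))
two-terms≤sumFin (suc n) f {suc i} {suc j} i≢j =
  ≤-trans (two-terms≤sumFin n (f ∘ suc) (i≢j ∘ cong suc)) (m≤n+m _ _)

three-terms≤sumFin : ∀ n (f : Fin n → ℕ) {i j l} → i ≢ j → i ≢ l → j ≢ l → f i + f j + f l ≤ sumFin n f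
three-terms≤sumFin (suc n) f {zero}  {zero}  {_}     i≢j _   _   = ⊥-elim (i≢j refl)
three-terms≤sumFin (suc n) f {zero}  {suc _} {zero}  _   i≢l _   = ⊥-elim (i≢l refl)
three-terms≤sumFin (suc n) f {suc _} {zero}  {zero}  _   _   j≢l = ⊥-elim (j≢l refl)
three-terms≤sumFin (suc n) f {zero}  {suc j} {suc l} _   _   j≢l =
  ≤-trans (≤-reflexive (+-assoc (f zero) _ _)) (+-monoʳ-≤ (f zero) (two-terms≤sumFin n (f ∘ suc) (j≢l ∘ cong suc)))
three-terms≤sumFin (suc n) f {suc i} {zero}  {suc l} _   i≢l _   =
  ≤-trans (≤-reflexive (rearrange (f (suc i)) (f zero) (f (suc l))))
          (+-monoʳ-≤ (f zero) (two-terms≤sumFin n (f ∘ suc) (i≢l ∘ cong suc)))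
  where
  rearrange : ∀ x y z → x + y + z ≡ y + (x + z)
  rearrange = solve-∀
three-terms≤sumFin (suc n) f {suc i} {suc j} {zero}  i≢j _   _   =
  ≤-trans (≤-reflexive (+-comm (f (suc i) + f (suc j)) (f zero)))
          (+-monoʳ-≤ (f zero) (two-terms≤sumFin n (f ∘ suc) (i≢j ∘ cong suc)))
three-terms≤sumFin (suc n) f {suc i} {suc j} {suc l} i≢j i≢l j≢l =
  ≤-trans (three-terms≤sumFin n (f ∘ suc) (i≢j ∘ cong suc) (i≢l ∘ cong suc) (j≢l ∘ cong suc)) (m≤n+m _ _)

sumFin-indicator-toℕ≡ᵇ : ∀ n t → sumFin n (λ a → indicator (toℕ a ≡ᵇ t)) ≤ 1
sumFin-indicator-toℕ≡ᵇ zero    t       = z≤n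
sumFin-indicator-toℕ≡ᵇ (suc n) zero    = s≤s (≤-reflexive (trans (sumFin-const n 0) (*-zeroʳ n)))
sumFin-indicator-toℕ≡ᵇ (suc n) (suc t) = sumFin-indicator-toℕ≡ᵇ n t

countList-mono : ∀ {A : Set} {p q : A → Bool} → (∀ x → p x ≡ true → q x ≡ true) →
  ∀ xs → countList p xs ≤ countList q xs
countList-mono p⇒q []       = z≤n
countList-mono p⇒q (x ∷ xs) = +-mono-≤ (indicator-mono (p⇒q x)) (countList-mono p⇒q xs)

countList-cong : ∀ {A : Set} {p q : A → Bool} → (∀ x → p x ≡ q x) →
  ∀ xs → countList p xs ≡ countList q xs
countList-cong p≗q []       = refl
countList-cong p≗q (x ∷ xs) = cong₂ _+_ (cong indicator (p≗q x)) (countList-cong p≗q xs)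

countList-∨ : ∀ {A : Set} (p q : A → Bool) xs →
  countList (λ x → p x ∨ q x) xs ≤ countList p xs + countList q xs
countList-∨ p q []       = z≤n
countList-∨ p q (x ∷ xs) =
  ≤-trans (+-mono-≤ (indicator-∨ (p x) (q x)) (countList-∨ p q xs))
          (≤-reflexive (interchange (indicator (p x)) (indicator (q x)) _ _))
  where
  interchange : ∀ a b c d → a + b + (c + d) ≡ a + c + (b + d)
  interchange = solve-∀

countList-++ : ∀ {A : Set} (p : A → Bool) xs ys → countList p (xs ++ ys) ≡ countList p xs + countList p ys
countList-++ p []       ys = refl
countList-++ p (x ∷ xs) ys = trans (cong (indicator (p x) +_) (countList-++ p xs ys)) (sym (+-assoc (indicator (p x)) _ _))

countList-map : ∀ {A B : Set} (p : B → Bool) (f : A → B) xs → countList p (map f xs) ≡ countList (p ∘ f) xs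
countList-map p f []       = refl
countList-map p f (x ∷ xs) = cong (indicator (p (f x)) +_) (countList-map p f xs)

countList-concatMap-tabulate : ∀ {A B : Set} n (p : A → Bool) (f : B → List A) (g : Fin n → B) →
  countList p (concatMap f (tabulate g)) ≡ sumFin n (λ i → countList p (f (g i)))
countList-concatMap-tabulate zero    p f g = refl
countList-concatMap-tabulate (suc n) p f g =
  trans (countList-++ p (f (g zero)) _) (cong (countList p (f (g zero)) +_) (countList-concatMap-tabulate n p f (g ∘ suc)))

countList-allVertices-suc : ∀ d n (p : Vertex (suc d) n → Bool) →
  countList p (allVertices (suc d) n) ≡ sumFin n (λ a → countList (λ y → p (a ∷ y)) (allVertices d n))
countList-allVertices-suc d n p =
  trans (countList-concatMap-tabulate n p _ id)
        (sumFin-cong n (λ a → countList-map p (a ∷_) (allVertices d n)))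

countList-true-allVertices : ∀ d n → countList (λ _ → true) (allVertices d n) ≡ n ^ d
countList-true-allVertices zero    n = refl
countList-true-allVertices (suc d) n =
  trans (countList-allVertices-suc d n _)
        (trans (sumFin-cong n (λ _ → countList-true-allVertices d n)) (sumFin-const n (n ^ d)))

countList-const-allVertices : ∀ d n e → countList (λ _ → e) (allVertices d n) ≡ indicator e * n ^ d
countList-const-allVertices d n true  = trans (countList-true-allVertices d n) (sym (+-identityʳ _))
countList-const-allVertices zero    n false = refl
countList-const-allVertices (suc d) n false =
  trans (countList-allVertices-suc d n _)
        (trans (sumFin-cong n (λ _ → countList-const-allVertices d n false))
               (trans (sumFin-const n 0) (*-zeroʳ n)))

-- Monotone dynamos from activation times

step-mono : ∀ {d n} r {ω ω′ : Config d n} → (∀ y → ω y ≡ true → ω′ y ≡ true) →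
  ∀ x → step r ω x ≡ true → step r ω′ x ≡ true
step-mono {d} {n} r ω⇒ω′ x e = ≤ᵇ-true {r} (≤-trans (≤ᵇ-sound {r} e)
  (countList-mono (λ y q → ∧-true (∧-trueˡ (adjacent x y) q) (ω⇒ω′ y (∧-trueʳ (adjacent x y) q))) (allVertices d n)))

-- Since pred 0 = 0, a vertex with τ x = 0 must have r neighbours that are active from the start.
isMonotoneDynamo-byActivationTime : ∀ {d n} r (ω : Config d n) (τ : Vertex d n → ℕ) (T : ℕ) →
  (∀ x → ω x ≡ true → τ x ≡ 0) → (∀ x → τ x ≡ 0 → ω x ≡ true) → (∀ x → τ x ≤ T) →
  (∀ x → r ≤ activeNeighbours (λ y → τ y ≤ᵇ pred (τ x)) x) →
  IsMonotoneDynamo r ω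
isMonotoneDynamo-byActivationTime {d} {n} r ω τ T ω⇒τ≡0 τ≡0⇒ω τ≤T earlier =
  (T , λ t T≤t x → active-after-τ t x (≤-trans (τ≤T x) T≤t)) , monotone
  where
  active-after-τ : ∀ t x → τ x ≤ t → evolve r ω t x ≡ true
  active-after-τ zero    x τ≤0 = τ≡0⇒ω x (n≤0⇒n≡0 τ≤0)
  active-after-τ (suc t) x τ≤t = ≤ᵇ-true {r} (≤-trans (earlier x) (countList-mono
    (λ y q → ∧-true (∧-trueˡ (adjacent x y) q)
                    (active-after-τ t y (≤-trans (≤ᵇ-sound (∧-trueʳ (adjacent x y) q)) (pred-mono-≤ τ≤t))))
    (allVertices d n)))

  monotone : IsMonotone r ω
  monotone zero    x e = active-after-τ 1 x (≤-trans (≤-reflexive (ω⇒τ≡0 x e)) z≤n)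
  monotone (suc t) x e = step-mono r (monotone t) x e

module Cycle (m : ℕ) where

  next : Fin (suc m) → Fin (suc m)
  next a with toℕ a <? m
  ... | yes a<m = fromℕ< (s≤s a<m)
  ... | no  _   = zero

  prev : Fin (suc m) → Fin (suc m)
  prev zero    = fromℕ m
  prev (suc a) = inject₁ a

  toℕ-next-cases : ∀ a → (toℕ a < m × toℕ (next a) ≡ suc (toℕ a)) ⊎ (toℕ a ≡ m × toℕ (next a) ≡ 0)
  toℕ-next-cases a with toℕ a <? m
  ... | yes a<m = inj₁ (a<m , toℕ-fromℕ< (s≤s a<m))
  ... | no  a≮m = inj₂ (≤-antisym (s≤s⁻¹ (toℕ<n a)) (≮⇒≥ a≮m) , refl)

  toℕ-next : ∀ a → toℕ a < m → toℕ (next a) ≡ suc (toℕ a)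
  toℕ-next a a<m with toℕ-next-cases a
  ... | inj₁ (_ , eq)  = eq
  ... | inj₂ (a≡m , _) = ⊥-elim (<-irrefl a≡m a<m)

  toℕ-next-last : ∀ a → toℕ a ≡ m → toℕ (next a) ≡ 0
  toℕ-next-last a a≡m with toℕ-next-cases a
  ... | inj₁ (a<m , _) = ⊥-elim (<-irrefl a≡m a<m)
  ... | inj₂ (_ , eq)  = eq

  toℕ-prev-zero : ∀ a → toℕ a ≡ 0 → toℕ (prev a) ≡ m
  toℕ-prev-zero zero _ = toℕ-fromℕ m

  toℕ-prev-suc : ∀ a {j} → toℕ a ≡ suc j → toℕ (prev a) ≡ j
  toℕ-prev-suc (suc a) eq = trans (toℕ-inject₁ a) (suc-injective eq)

  next≢ : 1 ≤ m → ∀ a → toℕ a ≢ toℕ (next a)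
  next≢ 1≤m a with toℕ-next-cases a
  ... | inj₁ (_ , eq)   = λ e → 1+n≢n (sym (trans e eq))
  ... | inj₂ (a≡m , eq) = λ e → <-irrefl (sym (trans (sym a≡m) (trans e eq))) 1≤m

  prev≢ : 1 ≤ m → ∀ a → toℕ a ≢ toℕ (prev a)
  prev≢ 1≤m zero    e = <-irrefl (trans e (toℕ-fromℕ m)) 1≤m
  prev≢ _   (suc a) e = 1+n≢n (trans e (toℕ-inject₁ a))

  next≢prev : 2 ≤ m → ∀ a → toℕ (next a) ≢ toℕ (prev a)
  next≢prev 2≤m zero e with toℕ-next-cases zero
  ... | inj₁ (_ , eq) = <-irrefl (trans (sym eq) (trans e (toℕ-fromℕ m))) 2≤m
  ... | inj₂ (0≡m , _) = <-irrefl 0≡m (≤-trans (s≤s z≤n) 2≤m)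
  next≢prev 2≤m (suc a) e with toℕ-next-cases (suc a)
  ... | inj₁ (_ , eq) = m≢1+n+m (toℕ a) {1} (trans (sym (toℕ-inject₁ a)) (trans (sym e) eq))
  ... | inj₂ (a+1≡m , eq) = <-irrefl refl (≤-trans 2≤m (≤-reflexive (trans (sym a+1≡m) (cong suc a≡0))))
    where
    a≡0 : toℕ a ≡ 0
    a≡0 = trans (sym (toℕ-inject₁ a)) (trans (sym e) eq)

  cycAdj-step : (a b : Fin (suc m)) → toℕ b ≡ suc (toℕ a) → cycAdj a b ≡ true
  cycAdj-step a b e rewrite e | ≡ᵇ-false {toℕ a} {suc (toℕ a)} (1+n≢n ∘ sym) | ≡ᵇ-true {toℕ a} refl = refl

  cycAdj-step⁻ : (a b : Fin (suc m)) → toℕ a ≡ suc (toℕ b) → cycAdj a b ≡ true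
  cycAdj-step⁻ a b e rewrite e | ≡ᵇ-false {suc (toℕ b)} {toℕ b} 1+n≢n | ≡ᵇ-true {toℕ b} refl =
    ∨-trueʳ (suc (suc (toℕ b)) ≡ᵇ toℕ b) refl

  cycAdj-wrap : 1 ≤ m → (a b : Fin (suc m)) → toℕ a ≡ m → toℕ b ≡ 0 → cycAdj a b ≡ true
  cycAdj-wrap (s≤s z≤n) a b ea eb rewrite ea | eb | ≡ᵇ-true {m} refl =
    ∨-trueʳ (suc m ≡ᵇ 0) (∨-trueʳ (1 ≡ᵇ m) refl)

  cycAdj-wrap⁻ : 1 ≤ m → (a b : Fin (suc m)) → toℕ a ≡ 0 → toℕ b ≡ m → cycAdj a b ≡ true
  cycAdj-wrap⁻ (s≤s z≤n) a b ea eb rewrite ea | eb | ≡ᵇ-true {m} refl =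
    ∨-trueʳ (1 ≡ᵇ m) (∨-trueʳ (suc m ≡ᵇ 0) (∨-trueʳ ((1 ≡ᵇ suc m) ∧ (m ≡ᵇ 0)) refl))

  cycAdj-next : 1 ≤ m → ∀ a → cycAdj a (next a) ≡ true
  cycAdj-next 1≤m a with toℕ-next-cases a
  ... | inj₁ (_ , eq)   = cycAdj-step a (next a) eq
  ... | inj₂ (a≡m , eq) = cycAdj-wrap 1≤m a (next a) a≡m eq

  cycAdj-prev : 1 ≤ m → ∀ a → cycAdj a (prev a) ≡ true
  cycAdj-prev 1≤m zero    = cycAdj-wrap⁻ 1≤m zero (prev zero) refl (toℕ-fromℕ m)
  cycAdj-prev 1≤m (suc a) = cycAdj-step⁻ (suc a) (prev (suc a)) (cong suc (sym (toℕ-inject₁ a)))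

  -- The number of coordinates i such that P holds at x with x i replaced by σ (x i).
  shiftCount : ∀ {d} → (Fin (suc m) → Fin (suc m)) → (Vertex d (suc m) → Bool) → Vertex d (suc m) → ℕ
  shiftCount σ P []      = 0
  shiftCount σ P (a ∷ x) = indicator (P (σ a ∷ x)) + shiftCount σ (λ y → P (a ∷ y)) x

  shiftCount-mono : ∀ {d} σ {P Q : Vertex d (suc m) → Bool} → (∀ y → P y ≡ true → Q y ≡ true) →
    ∀ x → shiftCount σ P x ≤ shiftCount σ Q x
  shiftCount-mono σ P⇒Q []      = z≤n
  shiftCount-mono σ P⇒Q (a ∷ x) = +-mono-≤ (indicator-mono (P⇒Q (σ a ∷ x))) (shiftCount-mono σ (P⇒Q ∘ (a ∷_)) x)

  shiftCount-cong : ∀ {d} σ {P Q : Vertex d (suc m) → Bool} → (∀ y → P y ≡ Q y) →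
    ∀ x → shiftCount σ P x ≡ shiftCount σ Q x
  shiftCount-cong σ P≗Q []      = refl
  shiftCount-cong σ P≗Q (a ∷ x) = cong₂ _+_ (cong indicator (P≗Q (σ a ∷ x))) (shiftCount-cong σ (P≗Q ∘ (a ∷_)) x)

  shiftCount-true : ∀ {d} σ (x : Vertex d (suc m)) → shiftCount σ (λ _ → true) x ≡ d
  shiftCount-true σ []      = refl
  shiftCount-true σ (a ∷ x) = cong suc (shiftCount-true σ x)

  shiftCount-const : ∀ {d} σ {P : Vertex d (suc m) → Bool} → (∀ y → P y ≡ true) →
    ∀ x → shiftCount σ P x ≡ d
  shiftCount-const σ P≡true x = trans (shiftCount-cong σ P≡true x) (shiftCount-true σ x)

  indicator≤countList-eqVertex : ∀ d (P : Vertex d (suc m) → Bool) x →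
    indicator (P x) ≤ countList (λ y → eqVertex x y ∧ P y) (allVertices d (suc m))
  indicator≤countList-eqVertex zero    P [] = m≤m+n _ _
  indicator≤countList-eqVertex (suc d) P (a ∷ x) = begin
    indicator (P (a ∷ x))
      ≤⟨ indicator≤countList-eqVertex d (P ∘ (a ∷_)) x ⟩
    countList (λ y → eqVertex x y ∧ P (a ∷ y)) (allVertices d (suc m))
      ≤⟨ countList-mono (λ y e → ∧-true (∧-true (≡ᵇ-true {toℕ a} refl) (∧-trueˡ _ e)) (∧-trueʳ (eqVertex x y) e))
                        (allVertices d (suc m)) ⟩
    countList (λ y → eqVertex (a ∷ x) (a ∷ y) ∧ P (a ∷ y)) (allVertices d (suc m))
      ≤⟨ term≤sumFin (suc m) E a ⟩
    sumFin (suc m) E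
      ≡⟨ countList-allVertices-suc d (suc m) (λ y → eqVertex (a ∷ x) y ∧ P y) ⟨
    countList (λ y → eqVertex (a ∷ x) y ∧ P y) (allVertices (suc d) (suc m)) ∎
    where
    open ≤-Reasoning
    E : Fin (suc m) → ℕ
    E b = countList (λ y → eqVertex (a ∷ x) (b ∷ y) ∧ P (b ∷ y)) (allVertices d (suc m))

  shiftCounts≤activeNeighbours : 2 ≤ m → ∀ {d} (P : Config d (suc m)) x →
    shiftCount next P x + shiftCount prev P x ≤ activeNeighbours P x
  shiftCounts≤activeNeighbours 2≤m P []      = z≤n
  shiftCounts≤activeNeighbours 2≤m {suc d} P (a ∷ x) = begin
    (indicator (P (next a ∷ x)) + F) + (indicator (P (prev a ∷ x)) + B)
      ≡⟨ rearrange (indicator (P (next a ∷ x))) F (indicator (P (prev a ∷ x))) B ⟩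
    (F + B) + indicator (P (next a ∷ x)) + indicator (P (prev a ∷ x))
      ≤⟨ +-mono-≤ (+-mono-≤ (≤-trans (shiftCounts≤activeNeighbours 2≤m (P ∘ (a ∷_)) x) along-a)
                            (across (next a) (cycAdj-next 1≤m a)))
                  (across (prev a) (cycAdj-prev 1≤m a)) ⟩
    N a + N (next a) + N (prev a)
      ≤⟨ three-terms≤sumFin (suc m) N (next≢ 1≤m a ∘ cong toℕ) (prev≢ 1≤m a ∘ cong toℕ)
                                       (next≢prev 2≤m a ∘ cong toℕ) ⟩
    sumFin (suc m) N
      ≡⟨ countList-allVertices-suc d (suc m) (λ y → adjacent (a ∷ x) y ∧ P y) ⟨
    activeNeighbours P (a ∷ x) ∎
    where
    open ≤-Reasoning
    1≤m = ≤-trans (s≤s z≤n) 2≤m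
    F = shiftCount next (P ∘ (a ∷_)) x
    B = shiftCount prev (P ∘ (a ∷_)) x
    rearrange : ∀ p f q b → (p + f) + (q + b) ≡ (f + b) + p + q
    rearrange = solve-∀
    N : Fin (suc m) → ℕ
    N b = countList (λ y → adjacent (a ∷ x) (b ∷ y) ∧ P (b ∷ y)) (allVertices d (suc m))
    along-a : activeNeighbours (P ∘ (a ∷_)) x ≤ N a
    along-a = countList-mono (λ y e → ∧-true (∨-trueˡ _ (∧-true (≡ᵇ-true {toℕ a} refl) (∧-trueˡ _ e)))
                                             (∧-trueʳ (adjacent x y) e))
                             (allVertices d (suc m))
    across : ∀ b → cycAdj a b ≡ true → indicator (P (b ∷ x)) ≤ N b
    across b adj = ≤-trans (indicator≤countList-eqVertex d (P ∘ (b ∷_)) x)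
      (countList-mono (λ y e → ∧-true (∨-trueʳ (eqFin a b ∧ adjacent x y) (∧-true adj (∧-trueˡ _ e)))
                                      (∧-trueʳ (eqVertex x y) e))
                      (allVertices d (suc m)))

-- The periodic pattern

balanced⇒b≤c : ∀ {b c} → b ≡ c ⊎ suc b ≡ c → b ≤ c
balanced⇒b≤c (inj₁ b≡c)   = ≤-reflexive b≡c
balanced⇒b≤c (inj₂ 1+b≡c) = ≤-trans (n≤1+n _) (≤-reflexive 1+b≡c)

balanced⇒c≤1+b : ∀ {b c} → b ≡ c ⊎ suc b ≡ c → c ≤ suc b
balanced⇒c≤1+b (inj₁ b≡c)   = ≤-trans (≤-reflexive (sym b≡c)) (n≤1+n _)
balanced⇒c≤1+b (inj₂ 1+b≡c) = ≤-reflexive (sym 1+b≡c)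

module Pattern (b c k : ℕ) where

  r : ℕ
  r = suc (b + c)

  inBlocks : ℕ → Bool
  inBlocks u = (u <ᵇ k) ∨ ((c ≤ᵇ u) ∧ (u <ᵇ c + k))

  inPattern : ℕ → Bool
  inPattern t = inBlocks (t % r)

  window : ℕ → ℕ → ℕ
  window s zero    = 0
  window s (suc l) = indicator (inPattern s) + window (suc s) l

  inPattern-< : ∀ {t} → t < r → inPattern t ≡ inBlocks t
  inPattern-< t<r = cong inBlocks (m<n⇒m%n≡m t<r)

  inPattern-+r : ∀ s → inPattern (s + r) ≡ inPattern s
  inPattern-+r s = cong inBlocks ([m+n]%n≡m%n s r)

  inPattern-%-shift : ∀ s i → inPattern (s % r + i) ≡ inPattern (s + i)
  inPattern-%-shift s i = cong inBlocks (begin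
    (s % r + i) % r                   ≡⟨ [m+kn]%n≡m%n (s % r + i) (s / r) r ⟨
    (s % r + i + s / r * r) % r       ≡⟨ cong (_% r) (swap (s % r) i (s / r * r)) ⟩
    (s % r + s / r * r + i) % r       ≡⟨ cong (λ z → (z + i) % r) (m≡m%n+[m/n]*n s r) ⟨
    (s + i) % r                       ∎)
    where
    open ≡-Reasoning
    swap : ∀ x y z → x + y + z ≡ x + z + y
    swap = solve-∀

  window-++ : ∀ s l l′ → window s (l + l′) ≡ window s l + window (s + l) l′
  window-++ s zero    l′ rewrite +-identityʳ s = refl
  window-++ s (suc l) l′ rewrite window-++ (suc s) l l′ | +-suc s l = sym (+-assoc (indicator (inPattern s)) _ _)

  window-snoc : ∀ s l → window s (suc l) ≡ window s l + indicator (inPattern (s + l))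
  window-snoc s l = trans (cong (window s) (+-comm 1 l)) (trans (window-++ s l 1) (cong (window s l +_) (+-identityʳ _)))

  window-cong : ∀ s t l → (∀ i → i < l → inPattern (s + i) ≡ inPattern (t + i)) → window s l ≡ window t l
  window-cong s t zero    _ = refl
  window-cong s t (suc l) f = cong₂ _+_
    (cong indicator (trans (cong inPattern (sym (+-identityʳ s))) (trans (f 0 (s≤s z≤n)) (cong inPattern (+-identityʳ t)))))
    (window-cong (suc s) (suc t) l (λ i i<l → trans (cong inPattern (sym (+-suc s i)))
                                      (trans (f (suc i) (s≤s i<l)) (cong inPattern (+-suc t i)))))

  window-full : ∀ s l → (∀ i → i < l → inPattern (s + i) ≡ true) → window s l ≡ l
  window-full s zero    _ = refl
  window-full s (suc l) f rewrite trans (cong inPattern (sym (+-identityʳ s))) (f 0 (s≤s z≤n)) =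
    cong suc (window-full (suc s) l (λ i i<l → trans (cong inPattern (sym (+-suc s i))) (f (suc i) (s≤s i<l))))

  window-empty : ∀ s l → (∀ i → i < l → inPattern (s + i) ≡ false) → window s l ≡ 0
  window-empty s zero    _ = refl
  window-empty s (suc l) f rewrite trans (cong inPattern (sym (+-identityʳ s))) (f 0 (s≤s z≤n)) =
    window-empty (suc s) l (λ i i<l → trans (cong inPattern (sym (+-suc s i))) (f (suc i) (s≤s i<l)))

  window-⊆ : ∀ s off l L → off + l ≤ L → window (s + off) l ≤ window s L
  window-⊆ s off l L off+l≤L = begin
    window (s + off) l                          ≤⟨ m≤m+n _ _ ⟩
    window (s + off) l + window (s + off + l) e ≡⟨ window-++ (s + off) l e ⟨
    window (s + off) (l + e)                    ≤⟨ m≤n+m _ _ ⟩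
    window s off + window (s + off) (l + e)     ≡⟨ window-++ s off (l + e) ⟨
    window s (off + (l + e))                    ≡⟨ cong (window s) (trans (sym (+-assoc off l e)) (m+[n∸m]≡n off+l≤L)) ⟩
    window s L                                  ∎
    where
    open ≤-Reasoning
    e = L ∸ (off + l)

  window-%-shift : ∀ s t l → window (s % r + t) l ≡ window (s + t) l
  window-%-shift s t l = window-cong _ _ l (λ i _ →
    trans (cong inPattern (+-assoc (s % r) t i)) (trans (inPattern-%-shift s (t + i)) (cong inPattern (sym (+-assoc s t i)))))

  sumFin-inPattern : ∀ l s → sumFin l (λ a → indicator (inPattern (s + toℕ a))) ≡ window s l
  sumFin-inPattern zero    s = refl
  sumFin-inPattern (suc l) s = cong₂ _+_
    (cong (indicator ∘ inPattern) (+-identityʳ s))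
    (trans (sumFin-cong l (λ a → cong (indicator ∘ inPattern) (+-suc s (toℕ a)))) (sumFin-inPattern l (suc s)))

  inBlocks-low : ∀ {u} → u < k → inBlocks u ≡ true
  inBlocks-low u<k rewrite <ᵇ-true u<k = refl

  inBlocks-gap : ∀ {u} → k ≤ u → u < c → inBlocks u ≡ false
  inBlocks-gap k≤u u<c rewrite <ᵇ-false k≤u | ≤ᵇ-false u<c = refl

  inBlocks-high : ∀ {u} → c ≤ u → u < c + k → inBlocks u ≡ true
  inBlocks-high {u} c≤u u<c+k rewrite ≤ᵇ-true c≤u | <ᵇ-true u<c+k = ∨-trueʳ (u <ᵇ k) refl

  inBlocks-top : ∀ {u} → c + k ≤ u → inBlocks u ≡ false
  inBlocks-top {u} c+k≤u rewrite <ᵇ-false (≤-trans (m≤n+m k c) c+k≤u) | <ᵇ-false c+k≤u = ∧-zeroʳ (c ≤ᵇ u)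

  inBlocks-cases : ∀ u → inBlocks u ≡ true → u < k ⊎ (c ≤ u × u < c + k)
  inBlocks-cases u e with ∨-true-cases (u <ᵇ k) e
  ... | inj₁ u<k = inj₁ (<ᵇ-sound u<k)
  ... | inj₂ high = inj₂ (≤ᵇ-sound (∧-trueˡ (c ≤ᵇ u) high) , <ᵇ-sound (∧-trueʳ (c ≤ᵇ u) high))

  module Balanced (balanced : b ≡ c ⊎ suc b ≡ c) (k≤c : k ≤ c) where

    c+k≤r : c + k ≤ r
    c+k≤r = begin
      c + k     ≤⟨ +-monoʳ-≤ c k≤c ⟩
      c + c     ≤⟨ +-monoʳ-≤ c (balanced⇒c≤1+b balanced) ⟩
      c + suc b ≡⟨ +-suc c b ⟩
      suc (c + b) ≡⟨ cong suc (+-comm c b) ⟩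
      r         ∎
      where open ≤-Reasoning

    j : ℕ
    j = suc c ∸ k

    j+k≡1+c : j + k ≡ suc c
    j+k≡1+c = m∸n+n≡m (≤-trans k≤c (n≤1+n c))

    window-0-k : window 0 k ≡ k
    window-0-k = window-full 0 k (λ i i<k → trans (inPattern-< (≤-trans i<k (≤-trans (m≤n+m k c) c+k≤r)))
                                                  (inBlocks-low i<k))

    window-k-gap : window k (c ∸ k) ≡ 0
    window-k-gap = window-empty k (c ∸ k) (λ i i<c∸k →
      let k+i<c = ≤-trans (+-monoʳ-< k i<c∸k) (≤-reflexive (m+[n∸m]≡n k≤c)) in
      trans (inPattern-< (≤-trans k+i<c (≤-trans (m≤m+n c k) c+k≤r))) (inBlocks-gap (m≤m+n k i) k+i<c))

    window-c-k : window c k ≡ k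
    window-c-k = window-full c k (λ i i<k → let c+i<c+k = +-monoʳ-< c i<k in
      trans (inPattern-< (≤-trans c+i<c+k c+k≤r)) (inBlocks-high (m≤m+n c i) c+i<c+k))

    window-top : window (c + k) (r ∸ (c + k)) ≡ 0
    window-top = window-empty (c + k) (r ∸ (c + k)) (λ i i<r∸c+k →
      trans (inPattern-< (≤-trans (+-monoʳ-< (c + k) i<r∸c+k) (≤-reflexive (m+[n∸m]≡n c+k≤r))))
            (inBlocks-top (m≤m+n (c + k) i)))

    window-r-k : window r k ≡ k
    window-r-k = trans (window-cong r 0 k (λ i _ → trans (cong inPattern (+-comm r i)) (inPattern-+r i))) window-0-k

    window-0-r : window 0 r ≡ k + k
    window-0-r = begin
      window 0 r                                                  ≡⟨ cong (window 0) r-split ⟨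
      window 0 (k + (c ∸ k + (k + (r ∸ (c + k)))))                ≡⟨ window-++ 0 k _ ⟩
      window 0 k + window k (c ∸ k + (k + (r ∸ (c + k))))          ≡⟨ cong (window 0 k +_) (window-++ k (c ∸ k) _) ⟩
      window 0 k + (window k (c ∸ k) + window (k + (c ∸ k)) (k + (r ∸ (c + k))))
        ≡⟨ cong (λ z → window 0 k + (window k (c ∸ k) + window z (k + (r ∸ (c + k))))) (m+[n∸m]≡n k≤c) ⟩
      window 0 k + (window k (c ∸ k) + window c (k + (r ∸ (c + k))))
        ≡⟨ cong (λ z → window 0 k + (window k (c ∸ k) + z)) (window-++ c k _) ⟩
      window 0 k + (window k (c ∸ k) + (window c k + window (c + k) (r ∸ (c + k))))
        ≡⟨ cong₂ (λ x y → x + (window k (c ∸ k) + (y + window (c + k) (r ∸ (c + k))))) window-0-k window-c-k ⟩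
      k + (window k (c ∸ k) + (k + window (c + k) (r ∸ (c + k))))
        ≡⟨ cong₂ (λ x y → k + (x + (k + y))) window-k-gap window-top ⟩
      k + (k + 0)                                                 ≡⟨ cong (k +_) (+-identityʳ k) ⟩
      k + k                                                       ∎
      where
      open ≡-Reasoning
      r-split : k + (c ∸ k + (k + (r ∸ (c + k)))) ≡ r
      r-split = begin
        k + (c ∸ k + (k + (r ∸ (c + k))))   ≡⟨ +-assoc k (c ∸ k) _ ⟨
        k + (c ∸ k) + (k + (r ∸ (c + k)))   ≡⟨ cong (_+ (k + (r ∸ (c + k)))) (m+[n∸m]≡n k≤c) ⟩
        c + (k + (r ∸ (c + k)))             ≡⟨ +-assoc c k _ ⟨
        c + k + (r ∸ (c + k))               ≡⟨ m+[n∸m]≡n c+k≤r ⟩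
        r                                   ∎

    window-period : ∀ s → window s r ≡ k + k
    window-period zero    = window-0-r
    window-period (suc s) = trans (+-cancelˡ-≡ (indicator (inPattern s)) _ _ shift) (window-period s)
      where
      shift : indicator (inPattern s) + window (suc s) r ≡ indicator (inPattern s) + window s r
      shift = begin
        window s (suc r)                           ≡⟨ window-snoc s r ⟩
        window s r + indicator (inPattern (s + r)) ≡⟨ cong (λ z → window s r + indicator z) (inPattern-+r s) ⟩
        window s r + indicator (inPattern s)       ≡⟨ +-comm (window s r) _ ⟩
        indicator (inPattern s) + window s r       ∎
        where open ≡-Reasoning

    window-multiple : ∀ q s → window s (q * r) ≡ q * (k + k)
    window-multiple zero    s = refl
    window-multiple (suc q) s = trans (window-++ s r (q * r)) (cong₂ _+_ (window-period s) (window-multiple q (s + r)))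

    window-ahead : ∀ u t → u < t → t ∸ suc u + k ≤ b → window t k ≤ window (u + 1) b
    window-ahead u t u<t fits = subst (λ z → window z k ≤ window (u + 1) b)
      (trans (cong (_+ (t ∸ suc u)) (+-comm u 1)) (m+[n∸m]≡n u<t))
      (window-⊆ (u + 1) (t ∸ suc u) k b fits)

    window-after-unmarked : ∀ s → inPattern s ≡ false → k ≤ window (suc s) b
    window-after-unmarked s unmarked = begin
      k                      ≤⟨ from-residue (s % r) (m%n<n s r) unmarked ⟩
      window (s % r + 1) b   ≡⟨ window-%-shift s 1 b ⟩
      window (s + 1) b       ≡⟨ cong (λ z → window z b) (+-comm s 1) ⟩
      window (suc s) b       ∎
      where
      open ≤-Reasoning
      from-residue : ∀ u → u < r → inBlocks u ≡ false → k ≤ window (u + 1) b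
      from-residue u u<r unmarked with u <? k | u <? c | u <? c + k
      ... | yes u<k | _       | _         = contradiction (trans (sym (inBlocks-low u<k)) unmarked) λ ()
      ... | no  u≮k | yes u<c | _         = begin
        k                  ≡⟨ window-c-k ⟨
        window c k         ≤⟨ window-ahead u c u<c fits ⟩
        window (u + 1) b   ∎
        where
        off = c ∸ suc u
        fits : off + k ≤ b
        fits = s≤s⁻¹ (begin
          suc (off + k) ≤⟨ s≤s (+-monoʳ-≤ off (≮⇒≥ u≮k)) ⟩
          suc (off + u) ≡⟨ +-suc off u ⟨
          off + suc u   ≡⟨ m∸n+n≡m u<c ⟩
          c             ≤⟨ balanced⇒c≤1+b balanced ⟩
          suc b         ∎)
      ... | no  _   | no  u≮c | yes u<c+k = contradiction (trans (sym (inBlocks-high (≮⇒≥ u≮c) u<c+k)) unmarked) λ ()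
      ... | no  _   | no  _   | no  u≮c+k = begin
        k                  ≡⟨ window-r-k ⟨
        window r k         ≤⟨ window-ahead u r u<r fits ⟩
        window (u + 1) b   ∎
        where
        off = r ∸ suc u
        off+u≡b+c : off + u ≡ b + c
        off+u≡b+c = suc-injective (trans (sym (+-suc off u)) (m∸n+n≡m u<r))
        fits : off + k ≤ b
        fits = +-cancelʳ-≤ c (off + k) b (begin
          off + k + c   ≡⟨ +-assoc off k c ⟩
          off + (k + c) ≤⟨ +-monoʳ-≤ off (≤-trans (≤-reflexive (+-comm k c)) (≮⇒≥ u≮c+k)) ⟩
          off + u       ≡⟨ off+u≡b+c ⟩
          b + c         ∎)

    inPattern-+c : suc b ≡ c → ∀ s → inPattern s ≡ true → inPattern (s + c) ≡ true
    inPattern-+c 1+b≡c s marked =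
      trans (sym (inPattern-%-shift s c)) (from-residue (s % r) (m%n<n s r) marked)
      where
      r≡c+c : r ≡ c + c
      r≡c+c = trans (cong suc (+-comm b c)) (trans (sym (+-suc c b)) (cong (c +_) 1+b≡c))
      c≤r : c ≤ r
      c≤r = ≤-trans (m≤m+n c c) (≤-reflexive (sym r≡c+c))
      from-residue : ∀ u → u < r → inBlocks u ≡ true → inPattern (u + c) ≡ true
      from-residue u u<r marked with inBlocks-cases u marked
      ... | inj₁ u<k = trans (inPattern-< u+c<r) (inBlocks-high (m≤n+m c u) (≤-trans u+c<k+c (≤-reflexive (+-comm k c))))
        where
        u+c<k+c = +-monoˡ-< c u<k
        u+c<r = ≤-trans u+c<k+c (≤-trans (+-monoˡ-≤ c k≤c) (≤-reflexive (sym r≡c+c)))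
      ... | inj₂ (c≤u , u<c+k) = begin
        inPattern (u + c)           ≡⟨ cong inPattern u+c≡u∸c+r ⟩
        inPattern (u ∸ c + r)       ≡⟨ inPattern-+r (u ∸ c) ⟩
        inPattern (u ∸ c)           ≡⟨ inPattern-< (≤-trans u∸c<k (≤-trans k≤c c≤r)) ⟩
        inBlocks (u ∸ c)            ≡⟨ inBlocks-low u∸c<k ⟩
        true                        ∎
        where
        open ≡-Reasoning
        u+c≡u∸c+r : u + c ≡ u ∸ c + r
        u+c≡u∸c+r = trans (cong (_+ c) (sym (m∸n+n≡m c≤u))) (trans (+-assoc (u ∸ c) c c) (cong (u ∸ c +_) (sym r≡c+c)))
        u∸c<k : u ∸ c < k
        u∸c<k = +-cancelʳ-< c (u ∸ c) k (subst (_< k + c) (sym (m∸n+n≡m c≤u)) (≤-trans u<c+k (≤-reflexive (+-comm c k))))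

    -- The window [s, s + r) splits as {s}, then b positions, then c positions; when c = b + 1
    -- the first of those c positions is s + c, which is marked together with s.
    window-around-marked : ∀ s → inPattern s ≡ true →
      k + k + r ≡ suc c + suc c + (window (suc s) b + window (s + suc c) b)
    window-around-marked s marked = from balanced
      where
      W = window (suc s) b
      W′ = window (s + suc c) b
      period : k + k ≡ suc (W + window (suc s + b) c)
      period = begin
        k + k                                    ≡⟨ window-period s ⟨
        window s r                               ≡⟨ cong (λ z → indicator z + window (suc s) (b + c)) marked ⟩
        suc (window (suc s) (b + c))             ≡⟨ cong suc (window-++ (suc s) b c) ⟩
        suc (W + window (suc s + b) c)           ∎
        where open ≡-Reasoning
      from : b ≡ c ⊎ suc b ≡ c → k + k + r ≡ suc c + suc c + (W + W′)
      from (inj₁ refl) = begin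
        k + k + r                    ≡⟨ cong (_+ r) period ⟩
        suc (W + window (suc s + b) b) + r ≡⟨ cong (λ z → suc (W + window z b) + r) (sym (+-suc s b)) ⟩
        suc (W + W′) + suc (b + b)   ≡⟨ identity b W W′ ⟩
        suc b + suc b + (W + W′)     ∎
        where
        open ≡-Reasoning
        identity : ∀ b W W′ → suc (W + W′) + suc (b + b) ≡ suc b + suc b + (W + W′)
        identity = solve-∀
      from (inj₂ refl) = begin
        k + k + r                    ≡⟨ cong (_+ r) period ⟩
        suc (W + window (suc s + b) (suc b)) + r
          ≡⟨ cong (λ z → suc (W + (indicator z + window (suc (suc s + b)) b)) + r)
                  (trans (cong inPattern (sym (+-suc s b))) (inPattern-+c refl s marked)) ⟩
        suc (W + suc (window (suc (suc s + b)) b)) + r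
          ≡⟨ cong (λ z → suc (W + suc (window z b)) + r) (sym (trans (+-suc s (suc b)) (cong suc (+-suc s b)))) ⟩
        suc (W + suc W′) + suc (b + suc b)   ≡⟨ identity b W W′ ⟩
        suc (suc b) + suc (suc b) + (W + W′) ∎
        where
        open ≡-Reasoning
        identity : ∀ b W W′ → suc (W + suc W′) + suc (b + suc b) ≡ suc (suc b) + suc (suc b) + (W + W′)
        identity = solve-∀

    windows-around-marked : ∀ s → inPattern s ≡ true →
      r ≡ (j + j) + (window (suc s) b + window (s + suc c) b)
    windows-around-marked s marked = +-cancelˡ-≡ (k + k) r _ (begin
      k + k + r                                ≡⟨ window-around-marked s marked ⟩
      suc c + suc c + V                        ≡⟨ cong (λ z → z + z + V) j+k≡1+c ⟨
      (j + k) + (j + k) + V                    ≡⟨ identity j k V ⟩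
      k + k + (j + j + V)                      ∎)
      where
      open ≡-Reasoning
      V = window (suc s) b + window (s + suc c) b
      identity : ∀ j k V → (j + k) + (j + k) + V ≡ k + k + (j + j + V)
      identity = solve-∀

    r*window≤ : ∀ s l → r * window s l ≤ (k + k) * l + (k + k) * r
    r*window≤ s l = begin
      r * window s l                     ≤⟨ *-monoʳ-≤ r (m≤m+n (window s l) (window (s + l) (q * r ∸ l))) ⟩
      r * (window s l + window (s + l) (q * r ∸ l)) ≡⟨ cong (r *_) (window-++ s l (q * r ∸ l)) ⟨
      r * window s (l + (q * r ∸ l))     ≡⟨ cong (λ z → r * window s z) (m+[n∸m]≡n l≤q*r) ⟩
      r * window s (q * r)               ≡⟨ cong (r *_) (window-multiple q s) ⟩
      r * (q * (k + k))                  ≡⟨ identity r (l / r) (k + k) ⟩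
      (k + k) * (l / r * r) + (k + k) * r ≤⟨ +-monoˡ-≤ ((k + k) * r) (*-monoʳ-≤ (k + k) (m/n*n≤m l r)) ⟩
      (k + k) * l + (k + k) * r          ∎
      where
      open ≤-Reasoning
      q = suc (l / r)
      l≤q*r : l ≤ q * r
      l≤q*r = ≤-trans (≤-reflexive (m≡m%n+[m/n]*n l r)) (+-monoˡ-≤ (l / r * r) (<⇒≤ (m%n<n l r)))
      identity : ∀ r x K → r * (suc x * K) ≡ K * (x * r) + K * r
      identity = solve-∀

-- The initial configuration

module Construction (m : ℕ) (2≤m : 2 ≤ m) (b c k : ℕ) (balanced : b ≡ c ⊎ suc b ≡ c) (k≤c : k ≤ c) where

  open Cycle m
  open Pattern b c k
  open Balanced balanced k≤c

  n : ℕ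
  n = suc m

  -- weight i is the weight of a coordinate that is followed by i further coordinates.
  weight : ℕ → ℕ
  weight i = if i <ᵇ b then suc i else 0

  weight-< : ∀ {i} → i < b → weight i ≡ suc i
  weight-< i<b rewrite <ᵇ-true i<b = refl

  weight-≥ : ∀ {i} → b ≤ i → weight i ≡ 0
  weight-≥ b≤i rewrite <ᵇ-false b≤i = refl

  weight≤r : ∀ i → weight i ≤ r
  weight≤r i with i <ᵇ b in i<ᵇb
  ... | true  = ≤-trans (<ᵇ-sound i<ᵇb) (≤-trans (m≤m+n b c) (n≤1+n _))
  ... | false = z≤n

  colour : ∀ {d} → Vertex d n → ℕ
  colour []              = 0
  colour {suc d} (a ∷ x) = weight d * toℕ a + colour x

  coordinateSum : ∀ {d} → Vertex d n → ℕ
  coordinateSum []      = 0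
  coordinateSum (a ∷ x) = toℕ a + coordinateSum x

  extreme : Fin n → Bool
  extreme a = (toℕ a ≡ᵇ 0) ∨ (toℕ a ≡ᵇ m)

  boundary : ∀ {d} → Vertex d n → Bool
  boundary []      = false
  boundary (a ∷ x) = extreme a ∨ boundary x

  active : ∀ {d} → Config d n
  active x = boundary x ∨ inPattern (colour x)

  activationTime : ∀ {d} → Vertex d n → ℕ
  activationTime x = if active x then 0 else suc (coordinateSum x)

  earlier : ∀ {d} → Vertex d n → Config d n
  earlier x y = activationTime y ≤ᵇ pred (activationTime x)

  non-extreme-< : ∀ a → extreme a ≡ false → toℕ a < m
  non-extreme-< a ¬ext = ≤∧≢⇒< (s≤s⁻¹ (toℕ<n a)) λ a≡m →
    contradiction (trans (sym (≡ᵇ-true a≡m)) (proj₂ (∨-false _ ¬ext))) λ ()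

  non-extreme-suc : ∀ a → extreme a ≡ false → toℕ a ≡ suc (pred (toℕ a))
  non-extreme-suc a ¬ext = sym (suc-pred (toℕ a) ⦃ >-nonZero (n≢0⇒n>0 (λ a≡0 →
    contradiction (trans (sym (≡ᵇ-true a≡0)) (proj₁ (∨-false _ ¬ext))) λ ())) ⦄)

  forwardSum : ℕ → ℕ → ℕ
  forwardSum zero    s = 0
  forwardSum (suc i) s = indicator (inPattern (s + weight i)) + forwardSum i s

  -- Adding r ∸ weight i subtracts weight i modulo the period r.
  backwardSum : ℕ → ℕ → ℕ
  backwardSum zero    s = 0
  backwardSum (suc i) s = indicator (inPattern (s + (r ∸ weight i))) + backwardSum i s

  shiftCount-next-colour : ∀ {d} (x : Vertex d n) cc → boundary x ≡ false →
    shiftCount next (λ y → inPattern (cc + colour y)) x ≡ forwardSum d (cc + colour x)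
  shiftCount-next-colour []              cc _        = refl
  shiftCount-next-colour {suc d} (a ∷ x) cc interior = cong₂ _+_
    (cong (indicator ∘ inPattern) (begin
      cc + (weight d * toℕ (next a) + colour x)
        ≡⟨ cong (λ z → cc + (weight d * z + colour x)) (toℕ-next a (non-extreme-< a ext)) ⟩
      cc + (weight d * suc (toℕ a) + colour x)   ≡⟨ identity cc (weight d) (toℕ a) (colour x) ⟩
      cc + (weight d * toℕ a + colour x) + weight d ∎))
    (begin
      shiftCount next (λ y → inPattern (cc + (weight d * toℕ a + colour y))) x
        ≡⟨ shiftCount-cong next (λ y → cong inPattern (sym (+-assoc cc _ (colour y)))) x ⟩
      shiftCount next (λ y → inPattern (cc + weight d * toℕ a + colour y)) x
        ≡⟨ shiftCount-next-colour x (cc + weight d * toℕ a) rest ⟩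
      forwardSum d (cc + weight d * toℕ a + colour x)
        ≡⟨ cong (forwardSum d) (+-assoc cc _ (colour x)) ⟩
      forwardSum d (cc + (weight d * toℕ a + colour x)) ∎)
    where
    open ≡-Reasoning
    ext = proj₁ (∨-false (extreme a) interior)
    rest = proj₂ (∨-false (extreme a) interior)
    identity : ∀ cc w a X → cc + (w * suc a + X) ≡ cc + (w * a + X) + w
    identity = solve-∀

  shiftCount-prev-colour : ∀ {d} (x : Vertex d n) cc → boundary x ≡ false →
    shiftCount prev (λ y → inPattern (cc + colour y)) x ≡ backwardSum d (cc + colour x)
  shiftCount-prev-colour []              cc _        = refl
  shiftCount-prev-colour {suc d} (a ∷ x) cc interior = cong₂ _+_
    (cong indicator (begin
      inPattern (cc + (weight d * toℕ (prev a) + colour x))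
        ≡⟨ cong (λ z → inPattern (cc + (weight d * z + colour x))) (toℕ-prev-suc a (non-extreme-suc a ext)) ⟩
      inPattern t                 ≡⟨ inPattern-+r t ⟨
      inPattern (t + r)           ≡⟨ cong inPattern t+r≡ ⟩
      inPattern (cc + (weight d * toℕ a + colour x) + (r ∸ weight d)) ∎))
    (begin
      shiftCount prev (λ y → inPattern (cc + (weight d * toℕ a + colour y))) x
        ≡⟨ shiftCount-cong prev (λ y → cong inPattern (sym (+-assoc cc _ (colour y)))) x ⟩
      shiftCount prev (λ y → inPattern (cc + weight d * toℕ a + colour y)) x
        ≡⟨ shiftCount-prev-colour x (cc + weight d * toℕ a) rest ⟩
      backwardSum d (cc + weight d * toℕ a + colour x)
        ≡⟨ cong (backwardSum d) (+-assoc cc _ (colour x)) ⟩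
      backwardSum d (cc + (weight d * toℕ a + colour x)) ∎)
    where
    open ≡-Reasoning
    ext = proj₁ (∨-false (extreme a) interior)
    rest = proj₂ (∨-false (extreme a) interior)
    a′ = pred (toℕ a)
    t = cc + (weight d * a′ + colour x)
    identity : ∀ cc w a X → cc + (w * a + X) + w ≡ cc + (w * suc a + X)
    identity = solve-∀
    t+r≡ : t + r ≡ cc + (weight d * toℕ a + colour x) + (r ∸ weight d)
    t+r≡ = begin
      t + r                       ≡⟨ cong (t +_) (m+[n∸m]≡n (weight≤r d)) ⟨
      t + (weight d + (r ∸ weight d)) ≡⟨ +-assoc t (weight d) _ ⟨
      t + weight d + (r ∸ weight d)   ≡⟨ cong (_+ (r ∸ weight d)) (identity cc (weight d) a′ (colour x)) ⟩
      cc + (weight d * suc a′ + colour x) + (r ∸ weight d)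
        ≡⟨ cong (λ z → cc + (weight d * z + colour x) + (r ∸ weight d)) (non-extreme-suc a ext) ⟨
      cc + (weight d * toℕ a + colour x) + (r ∸ weight d) ∎

  forwardSum-≤b : ∀ i s → i ≤ b → forwardSum i s ≡ window (suc s) i
  forwardSum-≤b zero    s _     = refl
  forwardSum-≤b (suc i) s 1+i≤b = begin
    indicator (inPattern (s + weight i)) + forwardSum i s
      ≡⟨ cong₂ (λ w f → indicator (inPattern (s + w)) + f) (weight-< 1+i≤b) (forwardSum-≤b i s (≤-trans (n≤1+n i) 1+i≤b)) ⟩
    indicator (inPattern (s + suc i)) + window (suc s) i
      ≡⟨ cong (λ z → indicator (inPattern z) + window (suc s) i) (+-suc s i) ⟩
    indicator (inPattern (suc s + i)) + window (suc s) i
      ≡⟨ trans (+-comm _ (window (suc s) i)) (sym (window-snoc (suc s) i)) ⟩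
    window (suc s) (suc i) ∎
    where open ≡-Reasoning

  forwardSum-+b : ∀ p s → forwardSum (p + b) s ≡ p * indicator (inPattern s) + window (suc s) b
  forwardSum-+b zero    s = forwardSum-≤b b s ≤-refl
  forwardSum-+b (suc p) s = begin
    indicator (inPattern (s + weight (p + b))) + forwardSum (p + b) s
      ≡⟨ cong₂ (λ w f → indicator (inPattern (s + w)) + f) (weight-≥ (m≤n+m b p)) (forwardSum-+b p s) ⟩
    indicator (inPattern (s + 0)) + (p * indicator (inPattern s) + window (suc s) b)
      ≡⟨ cong (λ z → indicator (inPattern z) + (p * indicator (inPattern s) + window (suc s) b)) (+-identityʳ s) ⟩
    indicator (inPattern s) + (p * indicator (inPattern s) + window (suc s) b)
      ≡⟨ +-assoc (indicator (inPattern s)) _ _ ⟨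
    suc p * indicator (inPattern s) + window (suc s) b ∎
    where open ≡-Reasoning

  backwardSum-≤b : ∀ i s → i ≤ b → backwardSum i s ≡ window (s + (r ∸ i)) i
  backwardSum-≤b zero    s _     = refl
  backwardSum-≤b (suc i) s 1+i≤b = cong₂ _+_
    (cong (λ w → indicator (inPattern (s + (r ∸ w)))) (weight-< 1+i≤b))
    (trans (backwardSum-≤b i s (≤-trans (n≤1+n i) 1+i≤b))
           (cong (λ z → window z i) (trans (cong (s +_) (+-∸-assoc 1 i≤b+c)) (+-suc s _))))
    where
    i≤b+c : i ≤ b + c
    i≤b+c = ≤-trans (≤-trans (n≤1+n i) 1+i≤b) (m≤m+n b c)

  backwardSum-+b : ∀ p s → backwardSum (p + b) s ≡ p * indicator (inPattern s) + window (s + suc c) b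
  backwardSum-+b zero    s = trans (backwardSum-≤b b s ≤-refl) (cong (λ z → window (s + z) b) r∸b≡1+c)
    where
    r∸b≡1+c : r ∸ b ≡ suc c
    r∸b≡1+c = trans (cong (_∸ b) (sym (+-suc b c))) (m+n∸m≡n b (suc c))
  backwardSum-+b (suc p) s = begin
    indicator (inPattern (s + (r ∸ weight (p + b)))) + backwardSum (p + b) s
      ≡⟨ cong₂ (λ w f → indicator (inPattern (s + (r ∸ w))) + f) (weight-≥ (m≤n+m b p)) (backwardSum-+b p s) ⟩
    indicator (inPattern (s + r)) + (p * indicator (inPattern s) + window (s + suc c) b)
      ≡⟨ cong (λ z → indicator z + (p * indicator (inPattern s) + window (s + suc c) b)) (inPattern-+r s) ⟩
    indicator (inPattern s) + (p * indicator (inPattern s) + window (s + suc c) b)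
      ≡⟨ +-assoc (indicator (inPattern s)) _ _ ⟨
    suc p * indicator (inPattern s) + window (s + suc c) b ∎
    where open ≡-Reasoning

  shiftCounts-boundary : ∀ {d} (x : Vertex d n) → boundary x ≡ true →
    d + d ≤ suc (shiftCount next boundary x + shiftCount prev boundary x)
  shiftCounts-boundary {suc d} (a ∷ x) bd with bool-cases (extreme a)
  ... | inj₁ ext = begin
    suc d + suc d                ≡⟨ cong suc (+-suc d d) ⟩
    suc (suc (d + d))            ≤⟨ s≤s (+-monoˡ-≤ (d + d) one-neighbour-extreme) ⟩
    suc (p + q + (d + d))        ≡⟨ cong suc (interchange p q d d) ⟩
    suc ((p + d) + (q + d))      ≡⟨ cong₂ (λ f b → suc ((p + f) + (q + b))) F≡d B≡d ⟨
    suc ((p + F) + (q + B))      ∎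
    where
    open ≤-Reasoning
    p = indicator (boundary (next a ∷ x))
    q = indicator (boundary (prev a ∷ x))
    F = shiftCount next (boundary ∘ (a ∷_)) x
    B = shiftCount prev (boundary ∘ (a ∷_)) x
    F≡d = shiftCount-const next (λ y → ∨-trueˡ (boundary y) ext) x
    B≡d = shiftCount-const prev (λ y → ∨-trueˡ (boundary y) ext) x
    interchange : ∀ p q f b → p + q + (f + b) ≡ (p + f) + (q + b)
    interchange = solve-∀
    one-neighbour-extreme : 1 ≤ p + q
    one-neighbour-extreme with ∨-true-cases (toℕ a ≡ᵇ 0) ext
    ... | inj₁ a≡0 = ≤-trans (indicator-mono {true} λ _ →
            ∨-trueˡ (boundary x) (∨-trueʳ (toℕ (prev a) ≡ᵇ 0) (≡ᵇ-true (toℕ-prev-zero a (≡ᵇ-sound a≡0)))))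
          (m≤n+m q p)
    ... | inj₂ a≡m = ≤-trans (indicator-mono {true} λ _ →
            ∨-trueˡ (boundary x) (∨-trueˡ (toℕ (next a) ≡ᵇ m) (≡ᵇ-true (toℕ-next-last a (≡ᵇ-sound a≡m)))))
          (m≤m+n p q)
  ... | inj₂ ¬ext = begin
    suc d + suc d                                ≡⟨ cong suc (+-suc d d) ⟩
    suc (suc (d + d))                            ≤⟨ s≤s (s≤s (shiftCounts-boundary x bdx)) ⟩
    suc (suc (suc (F₀ + B₀)))                    ≤⟨ s≤s (s≤s (s≤s (+-mono-≤ (shiftCount-mono next widen x)
                                                                           (shiftCount-mono prev widen x)))) ⟩
    suc (suc (suc (F + B)))                      ≡⟨ cong suc (cong suc (sym (+-suc F B))) ⟩
    suc ((1 + F) + (1 + B))                      ≡⟨ cong₂ (λ p q → suc ((p + F) + (q + B)))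
                                                          (cong indicator (∨-trueʳ (extreme (next a)) bdx))
                                                          (cong indicator (∨-trueʳ (extreme (prev a)) bdx)) ⟨
    suc ((indicator (boundary (next a ∷ x)) + F) + (indicator (boundary (prev a ∷ x)) + B)) ∎
    where
    open ≤-Reasoning
    bdx : boundary x ≡ true
    bdx = trans (sym (cong (_∨ boundary x) ¬ext)) bd
    F₀ = shiftCount next boundary x
    B₀ = shiftCount prev boundary x
    F = shiftCount next (boundary ∘ (a ∷_)) x
    B = shiftCount prev (boundary ∘ (a ∷_)) x
    widen : ∀ y → boundary y ≡ true → boundary (a ∷ y) ≡ true
    widen y = ∨-trueʳ (extreme a)

  shiftCount-prev-smaller : ∀ {d} (x : Vertex d n) e → boundary x ≡ false →
    d ≤ shiftCount prev (λ y → suc (e + coordinateSum y) ≤ᵇ e + coordinateSum x) x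
  shiftCount-prev-smaller []      e _        = z≤n
  shiftCount-prev-smaller (a ∷ x) e interior = +-mono-≤
    (indicator-mono {true} λ _ → ≤ᵇ-true (≤-reflexive (begin
      suc (e + (toℕ (prev a) + coordinateSum x)) ≡⟨ cong (λ z → suc (e + (z + coordinateSum x))) (toℕ-prev-suc a ta) ⟩
      suc (e + (pred (toℕ a) + coordinateSum x)) ≡⟨ +-suc e _ ⟨
      e + (suc (pred (toℕ a)) + coordinateSum x) ≡⟨ cong (λ z → e + (z + coordinateSum x)) ta ⟨
      e + (toℕ a + coordinateSum x)              ∎)))
    (≤-trans (shiftCount-prev-smaller x (e + toℕ a) (proj₂ (∨-false (extreme a) interior)))
             (≤-reflexive (shiftCount-cong prev (λ y →
                cong₂ _≤ᵇ_ (cong suc (+-assoc e _ _)) (+-assoc e _ _)) x)))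
    where
    open ≡-Reasoning
    ta = non-extreme-suc a (proj₁ (∨-false (extreme a) interior))

  coordinateSum≤ : ∀ {d} (x : Vertex d n) → coordinateSum x ≤ d * m
  coordinateSum≤ []      = z≤n
  coordinateSum≤ (a ∷ x) = +-mono-≤ (s≤s⁻¹ (toℕ<n a)) (coordinateSum≤ x)

  activationTime≤ : ∀ {d} (x : Vertex d n) → activationTime x ≤ suc (d * m)
  activationTime≤ x with active x
  ... | true  = z≤n
  ... | false = s≤s (coordinateSum≤ x)

  active⇒activationTime≡0 : ∀ {d} (x : Vertex d n) → active x ≡ true → activationTime x ≡ 0
  active⇒activationTime≡0 x act rewrite act = refl

  activationTime≡0⇒active : ∀ {d} (x : Vertex d n) → activationTime x ≡ 0 → active x ≡ true
  activationTime≡0⇒active x t≡0 with active x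
  ... | true  = refl
  ... | false = contradiction t≡0 1+n≢0

  module LocalRule {d : ℕ} (d≡j+b : d ≡ j + b) (r<2d : r < 2 * d) where

    shiftCount-next-pattern : (x : Vertex d n) → boundary x ≡ false →
      shiftCount next (inPattern ∘ colour) x ≡ j * indicator (inPattern (colour x)) + window (suc (colour x)) b
    shiftCount-next-pattern x interior =
      trans (shiftCount-next-colour x 0 interior)
            (trans (cong (λ z → forwardSum z (colour x)) d≡j+b) (forwardSum-+b j (colour x)))

    shiftCount-prev-pattern : (x : Vertex d n) → boundary x ≡ false →
      shiftCount prev (inPattern ∘ colour) x ≡ j * indicator (inPattern (colour x)) + window (colour x + suc c) b
    shiftCount-prev-pattern x interior =
      trans (shiftCount-prev-colour x 0 interior)
            (trans (cong (λ z → backwardSum z (colour x)) d≡j+b) (backwardSum-+b j (colour x)))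

    r≤shiftCounts-active : (x : Vertex d n) → active x ≡ true →
      r ≤ shiftCount next active x + shiftCount prev active x
    r≤shiftCounts-active x act with bool-cases (boundary x)
    ... | inj₁ bd = s≤s⁻¹ (begin
      suc r                                                      ≤⟨ r<2d ⟩
      d + (d + 0)                                                ≡⟨ cong (d +_) (+-identityʳ d) ⟩
      d + d                                                      ≤⟨ shiftCounts-boundary x bd ⟩
      suc (shiftCount next boundary x + shiftCount prev boundary x)
        ≤⟨ s≤s (+-mono-≤ (shiftCount-mono next (λ y → ∨-trueˡ _) x) (shiftCount-mono prev (λ y → ∨-trueˡ _) x)) ⟩
      suc (shiftCount next active x + shiftCount prev active x)  ∎)
      where open ≤-Reasoning
    ... | inj₂ interior = begin
      r                                                 ≡⟨ windows-around-marked s marked ⟩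
      (j + j) + (W + W′)                                ≡⟨ identity j W W′ ⟩
      (j * 1 + W) + (j * 1 + W′)                        ≡⟨ cong (λ z → (j * indicator z + W) + (j * indicator z + W′)) marked ⟨
      (j * ι + W) + (j * ι + W′)                        ≡⟨ cong₂ _+_ (shiftCount-next-pattern x interior)
                                                                     (shiftCount-prev-pattern x interior) ⟨
      shiftCount next (inPattern ∘ colour) x + shiftCount prev (inPattern ∘ colour) x
        ≤⟨ +-mono-≤ (shiftCount-mono next (λ y → ∨-trueʳ (boundary y)) x)
                    (shiftCount-mono prev (λ y → ∨-trueʳ (boundary y)) x) ⟩
      shiftCount next active x + shiftCount prev active x ∎
      where
      open ≤-Reasoning
      s = colour x
      W = window (suc s) b
      W′ = window (s + suc c) b
      ι = indicator (inPattern s)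
      marked : inPattern s ≡ true
      marked = trans (sym (cong (_∨ inPattern s) interior)) act
      identity : ∀ j W W′ → (j + j) + (W + W′) ≡ (j * 1 + W) + (j * 1 + W′)
      identity = solve-∀

    r≡d+k : r ≡ d + k
    r≡d+k = begin
      suc (b + c)    ≡⟨ +-suc b c ⟨
      b + suc c      ≡⟨ cong (b +_) j+k≡1+c ⟨
      b + (j + k)    ≡⟨ +-assoc b j k ⟨
      b + j + k      ≡⟨ cong (_+ k) (trans (+-comm b j) (sym d≡j+b)) ⟩
      d + k          ∎
      where open ≡-Reasoning

    earlier-active : ∀ (x y : Vertex d n) → active y ≡ true → earlier x y ≡ true
    earlier-active x y act rewrite act = refl

    r≤shiftCounts-inactive : (x : Vertex d n) → active x ≡ false →
      r ≤ shiftCount next (earlier x) x + shiftCount prev (earlier x) x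
    r≤shiftCounts-inactive x inact = begin
      r     ≡⟨ trans r≡d+k (+-comm d k) ⟩
      k + d ≤⟨ +-mono-≤ forward backward ⟩
      shiftCount next (earlier x) x + shiftCount prev (earlier x) x ∎
      where
      open ≤-Reasoning
      interior = proj₁ (∨-false (boundary x) inact)
      unmarked = proj₂ (∨-false (boundary x) inact)
      forward : k ≤ shiftCount next (earlier x) x
      forward = begin
        k                                          ≤⟨ window-after-unmarked (colour x) unmarked ⟩
        window (suc (colour x)) b                  ≡⟨ cong (_+ window (suc (colour x)) b) (*-zeroʳ j) ⟨
        j * 0 + window (suc (colour x)) b          ≡⟨ cong (λ z → j * indicator z + window (suc (colour x)) b) unmarked ⟨
        j * indicator (inPattern (colour x)) + window (suc (colour x)) b ≡⟨ shiftCount-next-pattern x interior ⟨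
        shiftCount next (inPattern ∘ colour) x     ≤⟨ shiftCount-mono next (λ y → earlier-active x y ∘ ∨-trueʳ (boundary y)) x ⟩
        shiftCount next (earlier x) x              ∎
      smaller⇒earlier : ∀ y → (suc (coordinateSum y) ≤ᵇ coordinateSum x) ≡ true → earlier x y ≡ true
      smaller⇒earlier y smaller with active y
      ... | true  = refl
      ... | false rewrite inact = smaller
      backward : d ≤ shiftCount prev (earlier x) x
      backward = ≤-trans (shiftCount-prev-smaller x 0 interior) (shiftCount-mono prev smaller⇒earlier x)

    r≤activeNeighbours-earlier : (x : Vertex d n) → r ≤ activeNeighbours (earlier x) x
    r≤activeNeighbours-earlier x =
      ≤-trans (by-case (bool-cases (active x))) (shiftCounts≤activeNeighbours 2≤m (earlier x) x)
      where
      by-case : active x ≡ true ⊎ active x ≡ false →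
        r ≤ shiftCount next (earlier x) x + shiftCount prev (earlier x) x
      by-case (inj₁ act)   = ≤-trans (r≤shiftCounts-active x act)
        (+-mono-≤ (shiftCount-mono next (earlier-active x) x) (shiftCount-mono prev (earlier-active x) x))
      by-case (inj₂ inact) = r≤shiftCounts-inactive x inact

    active-isMonotoneDynamo : IsMonotoneDynamo r (active {d})
    active-isMonotoneDynamo = isMonotoneDynamo-byActivationTime r active activationTime (suc (d * m))
      active⇒activationTime≡0 activationTime≡0⇒active activationTime≤ r≤activeNeighbours-earlier

  extremes≤2 : sumFin n (indicator ∘ extreme) ≤ 2
  extremes≤2 = begin
    sumFin n (indicator ∘ extreme)
      ≤⟨ sumFin-mono n (λ a → indicator-∨ (toℕ a ≡ᵇ 0) (toℕ a ≡ᵇ m)) ⟩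
    sumFin n (λ a → indicator (toℕ a ≡ᵇ 0) + indicator (toℕ a ≡ᵇ m))
      ≡⟨ sumFin-+ n (λ a → indicator (toℕ a ≡ᵇ 0)) (λ a → indicator (toℕ a ≡ᵇ m)) ⟩
    sumFin n (λ a → indicator (toℕ a ≡ᵇ 0)) + sumFin n (λ a → indicator (toℕ a ≡ᵇ m))
      ≤⟨ +-mono-≤ (sumFin-indicator-toℕ≡ᵇ n 0) (sumFin-indicator-toℕ≡ᵇ n m) ⟩
    2 ∎
    where open ≤-Reasoning

  boundaryCount-suc≤ : ∀ d → countList boundary (allVertices (suc d) n) ≤ 2 * n ^ d + n * countList boundary (allVertices d n)
  boundaryCount-suc≤ d = begin
    countList boundary (allVertices (suc d) n)
      ≡⟨ countList-allVertices-suc d n boundary ⟩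
    sumFin n (λ a → countList (λ y → extreme a ∨ boundary y) (allVertices d n))
      ≤⟨ sumFin-mono n (λ a → ≤-trans (countList-∨ (λ _ → extreme a) boundary (allVertices d n))
                                      (≤-reflexive (cong (_+ S) (countList-const-allVertices d n (extreme a))))) ⟩
    sumFin n (λ a → indicator (extreme a) * n ^ d + S)
      ≡⟨ sumFin-+ n (λ a → indicator (extreme a) * n ^ d) (λ _ → S) ⟩
    sumFin n (λ a → indicator (extreme a) * n ^ d) + sumFin n (λ _ → S)
      ≡⟨ cong₂ _+_ (trans (sumFin-cong n (λ a → *-comm (indicator (extreme a)) (n ^ d)))
                          (sym (sumFin-*ˡ n (n ^ d) (indicator ∘ extreme))))
                   (sumFin-const n S) ⟩
    n ^ d * sumFin n (indicator ∘ extreme) + n * S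
      ≤⟨ +-monoˡ-≤ (n * S) (≤-trans (*-monoʳ-≤ (n ^ d) extremes≤2) (≤-reflexive (*-comm (n ^ d) 2))) ⟩
    2 * n ^ d + n * S ∎
    where
    open ≤-Reasoning
    S = countList boundary (allVertices d n)

  n*boundaryCount≤ : ∀ d → n * countList boundary (allVertices d n) ≤ (d + d) * n ^ d
  n*boundaryCount≤ zero    = ≤-reflexive (*-zeroʳ n)
  n*boundaryCount≤ (suc d) = begin
    n * countList boundary (allVertices (suc d) n)     ≤⟨ *-monoʳ-≤ n (boundaryCount-suc≤ d) ⟩
    n * (2 * n ^ d + n * S)                            ≡⟨ *-distribˡ-+ n (2 * n ^ d) (n * S) ⟩
    n * (2 * n ^ d) + n * (n * S)                      ≤⟨ +-monoʳ-≤ (n * (2 * n ^ d)) (*-monoʳ-≤ n (n*boundaryCount≤ d)) ⟩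
    n * (2 * n ^ d) + n * ((d + d) * n ^ d)            ≡⟨ identity n (n ^ d) d ⟩
    (suc d + suc d) * n ^ suc d                        ∎
    where
    open ≤-Reasoning
    S = countList boundary (allVertices d n)
    identity : ∀ n P d → n * (2 * P) + n * ((d + d) * P) ≡ (suc d + suc d) * (n * P)
    identity = solve-∀

  r*patternCount≤ : 1 ≤ b → ∀ d cc →
    r * countList (λ y → inPattern (cc + colour y)) (allVertices (suc d) n) ≤ n ^ d * ((k + k) * n + (k + k) * r)
  r*patternCount≤ 1≤b zero cc = begin
    r * countList (λ y → inPattern (cc + colour y)) (allVertices 1 n)
      ≡⟨ cong (r *_) (trans (countList-allVertices-suc 0 n _) (sumFin-cong n last-coordinate)) ⟩
    r * sumFin n (λ a → indicator (inPattern (cc + toℕ a)))  ≡⟨ cong (r *_) (sumFin-inPattern n cc) ⟩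
    r * window cc n                                          ≤⟨ r*window≤ cc n ⟩
    (k + k) * n + (k + k) * r                                ≡⟨ *-identityˡ _ ⟨
    1 * ((k + k) * n + (k + k) * r)                          ∎
    where
    open ≤-Reasoning
    last-coordinate : ∀ a → indicator (inPattern (cc + (weight 0 * toℕ a + 0))) + 0 ≡ indicator (inPattern (cc + toℕ a))
    last-coordinate a = trans (+-identityʳ _) (cong (λ z → indicator (inPattern (cc + z)))
      (trans (+-identityʳ _) (trans (cong (_* toℕ a) (weight-< 1≤b)) (*-identityˡ (toℕ a)))))
  r*patternCount≤ 1≤b (suc d) cc = begin
    r * countList (λ y → inPattern (cc + colour y)) (allVertices (suc (suc d)) n)
      ≡⟨ cong (r *_) (trans (countList-allVertices-suc (suc d) n _) (sumFin-cong n (λ a →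
           countList-cong (λ y → cong inPattern (sym (+-assoc cc (weight (suc d) * toℕ a) (colour y))))
                          (allVertices (suc d) n)))) ⟩
    r * sumFin n (λ a → P a)            ≡⟨ sumFin-*ˡ n r P ⟩
    sumFin n (λ a → r * P a)            ≤⟨ sumFin-mono n (λ a → r*patternCount≤ 1≤b d (cc + weight (suc d) * toℕ a)) ⟩
    sumFin n (λ _ → n ^ d * X)          ≡⟨ sumFin-const n _ ⟩
    n * (n ^ d * X)                     ≡⟨ *-assoc n (n ^ d) X ⟨
    n ^ suc d * X                       ∎
    where
    open ≤-Reasoning
    X = (k + k) * n + (k + k) * r
    P : Fin n → ℕ
    P a = countList (λ y → inPattern (cc + weight (suc d) * toℕ a + colour y)) (allVertices (suc d) n)

  r*size-active≤ : 1 ≤ b → ∀ d →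
    r * size (active {suc d}) ≤ 2 * k * n ^ suc d + r * (2 * suc d + 2 * k) * n ^ d
  r*size-active≤ 1≤b d = begin
    r * countList active (allVertices D n)  ≤⟨ *-monoʳ-≤ r (countList-∨ boundary (inPattern ∘ colour) (allVertices D n)) ⟩
    r * (S + M)                             ≡⟨ *-distribˡ-+ r S M ⟩
    r * S + r * M                           ≤⟨ +-mono-≤ (*-monoʳ-≤ r S≤) (r*patternCount≤ 1≤b d 0) ⟩
    r * ((D + D) * n ^ d) + n ^ d * ((k + k) * n + (k + k) * r) ≡⟨ identity r D (n ^ d) k n ⟩
    2 * k * (n * n ^ d) + r * (2 * D + 2 * k) * n ^ d           ∎
    where
    open ≤-Reasoning
    D = suc d
    S = countList boundary (allVertices D n)
    M = countList (inPattern ∘ colour) (allVertices D n)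
    S≤ : S ≤ (D + D) * n ^ d
    S≤ = *-cancelˡ-≤ n (≤-trans (n*boundaryCount≤ D) (≤-reflexive (identity′ (D + D) n (n ^ d))))
      where
      identity′ : ∀ x n P → x * (n * P) ≡ n * (x * P)
      identity′ = solve-∀
    identity : ∀ r D P k n → r * ((D + D) * P) + P * ((k + k) * n + (k + k) * r) ≡ 2 * k * (n * P) + r * (2 * D + 2 * k) * P
    identity = solve-∀

-- The two regimes

SmallMonotoneDynamo : (d n r bound : ℕ) → Set
SmallMonotoneDynamo d n r bound = Σ (Config d n) λ ω → IsMonotoneDynamo r ω × r * size ω ≤ bound

all-active-isMonotoneDynamo : ∀ {d r} m → 2 ≤ m → r ≤ d + d → IsMonotoneDynamo r (λ (_ : Vertex d (suc m)) → true)
all-active-isMonotoneDynamo {d} {r} m 2≤m r≤2d =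
  isMonotoneDynamo-byActivationTime r _ (λ _ → 0) 0 (λ _ _ → refl) (λ _ _ → refl) (λ _ → z≤n) λ x → begin
    r                                ≤⟨ r≤2d ⟩
    d + d                            ≡⟨ cong₂ _+_ (shiftCount-true next x) (shiftCount-true prev x) ⟨
    shiftCount next (λ _ → true) x + shiftCount prev (λ _ → true) x
                                     ≤⟨ shiftCounts≤activeNeighbours 2≤m (λ _ → true) x ⟩
    activeNeighbours (λ _ → true) x  ∎
  where
  open Cycle m
  open ≤-Reasoning

all-active-monotoneDynamo : ∀ {d r} m → 2 ≤ m → r ≡ 2 * d →
  SmallMonotoneDynamo d (suc m) r (2 * (r ∸ d) * suc m ^ d)
all-active-monotoneDynamo {d} m 2≤m refl =
  (λ _ → true) ,
  all-active-isMonotoneDynamo m 2≤m (≤-reflexive (cong (d +_) (+-identityʳ d))) ,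
  ≤-reflexive (begin
    2 * d * size {d} {suc m} (λ _ → true)  ≡⟨ cong (2 * d *_) (countList-true-allVertices d (suc m)) ⟩
    2 * d * suc m ^ d                      ≡⟨ cong (λ k → 2 * k * suc m ^ d) (trans (m+n∸m≡n d (d + 0)) (+-identityʳ d)) ⟨
    2 * (2 * d ∸ d) * suc m ^ d            ∎)
  where open ≡-Reasoning

balanced-split : ∀ s → Σ ℕ λ b → Σ ℕ λ c → (b ≡ c ⊎ suc b ≡ c) × b + c ≡ s
balanced-split zero = 0 , 0 , inj₁ refl , refl
balanced-split (suc s) with balanced-split s
... | b , c , inj₁ b≡c   , b+c≡s = b , suc c , inj₂ (cong suc b≡c) , trans (+-suc b c) (cong suc b+c≡s)
... | b , c , inj₂ 1+b≡c , b+c≡s = c , c , inj₁ refl , trans (cong (_+ c) (sym 1+b≡c)) (cong suc b+c≡s)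

-- k = r - d is the length of the marked blocks and j = c + 1 - k the number of weight-0 coordinates.
record Parameters (d r : ℕ) : Set where
  field
    b c      : ℕ
    balanced : b ≡ c ⊎ suc b ≡ c
    r≡1+b+c  : r ≡ suc (b + c)
    k≤c      : r ∸ d ≤ c
    1≤b      : 1 ≤ b
    d≡j+b    : d ≡ suc c ∸ (r ∸ d) + b

parameters : ∀ {d r} → d + 1 ≤ r → r < 2 * d → Parameters d r
parameters {d} {r} d+1≤r r<2d with subst (_≤ r) (+-comm d 1) d+1≤r
parameters {d} {suc r′} _ r<2d | s≤s d≤r′ with balanced-split r′
... | b , c , balanced , b+c≡r′ = record
  { b = b ; c = c ; balanced = balanced ; r≡1+b+c = cong suc (sym b+c≡r′)
  ; k≤c = k≤c ; 1≤b = 1≤b ; d≡j+b = d≡j+b }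
  where
  2+r′≤2d : suc (suc r′) ≤ d + d
  2+r′≤2d = ≤-trans r<2d (≤-reflexive (cong (d +_) (+-identityʳ d)))
  k = suc r′ ∸ d
  k+d≡r : k + d ≡ suc r′
  k+d≡r = m∸n+n≡m (≤-trans d≤r′ (n≤1+n r′))
  1+k≤d : suc k ≤ d
  1+k≤d = +-cancelʳ-≤ d (suc k) d (≤-trans (≤-reflexive (cong suc k+d≡r)) 2+r′≤2d)
  k≤c : k ≤ c
  k≤c = ≮⇒≥ λ c<k → 1+n≰n (begin
    suc (suc r′)          ≡⟨ cong (λ z → suc (suc z)) b+c≡r′ ⟨
    suc (suc (b + c))     ≡⟨ cong suc (+-suc b c) ⟨
    suc b + suc c         ≤⟨ +-mono-≤ (≤-trans (s≤s (balanced⇒b≤c balanced)) c<k) c<k ⟩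
    k + k                 ≤⟨ +-monoʳ-≤ k (≤-trans (n≤1+n k) 1+k≤d) ⟩
    k + d                 ≡⟨ k+d≡r ⟩
    suc r′                ∎)
    where open ≤-Reasoning
  1≤b : 1 ≤ b
  1≤b = n≢0⇒n>0 λ b≡0 → 1+n≰n (begin
    suc (suc 0)   ≤⟨ +-cancelʳ-≤ d 2 d (≤-trans (s≤s (s≤s d≤r′)) 2+r′≤2d) ⟩
    d             ≤⟨ d≤r′ ⟩
    r′            ≡⟨ b+c≡r′ ⟨
    b + c         ≡⟨ cong (_+ c) b≡0 ⟩
    c             ≤⟨ ≤-trans (balanced⇒c≤1+b balanced) (≤-reflexive (cong suc b≡0)) ⟩
    1             ∎)
    where open ≤-Reasoning
  d≡j+b : d ≡ suc c ∸ k + b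
  d≡j+b = +-cancelʳ-≡ k d (suc c ∸ k + b) (begin
    d + k                 ≡⟨ trans (+-comm d k) k+d≡r ⟩
    suc r′                ≡⟨ cong suc b+c≡r′ ⟨
    suc (b + c)           ≡⟨ +-suc b c ⟨
    b + suc c             ≡⟨ cong (b +_) (m∸n+n≡m (≤-trans k≤c (n≤1+n c))) ⟨
    b + (suc c ∸ k + k)   ≡⟨ +-assoc b (suc c ∸ k) k ⟨
    b + (suc c ∸ k) + k   ≡⟨ cong (_+ k) (+-comm b (suc c ∸ k)) ⟩
    suc c ∸ k + b + k     ∎)
    where open ≡-Reasoning

sparse-monotoneDynamo : ∀ {d r} m → 2 ≤ m → suc d + 1 ≤ r → r < 2 * suc d →
  SmallMonotoneDynamo (suc d) (suc m) r (2 * (r ∸ suc d) * suc m ^ suc d + r * (2 * suc d + 2 * (r ∸ suc d)) * suc m ^ d)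
sparse-monotoneDynamo {d} m 2≤m d+1≤r r<2d with parameters {suc d} d+1≤r r<2d
... | record { b = b ; c = c ; balanced = balanced ; r≡1+b+c = refl ; k≤c = k≤c ; 1≤b = 1≤b ; d≡j+b = d≡j+b } =
  active , active-isMonotoneDynamo , r*size-active≤ 1≤b d
  where
  open Construction m 2≤m b c (suc (b + c) ∸ suc d) balanced k≤c
  open LocalRule {suc d} d≡j+b r<2d

theorem3 : (d r : ℕ) → 1 ≤ d → d + 1 ≤ r → r ≤ 2 * d →
    Σ ℕ (λ C → Σ ℕ (λ n₀ → 0 < C ×
      ((n : ℕ) → n₀ ≤ n →
        Σ (Config d n) (λ ω → IsMonotoneDynamo r ω ×
          r * size ω ≤ 2 * (r ∸ d) * n ^ d + r * C * n ^ (d ∸ 1)))))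
theorem3 zero    _ () _ _
theorem3 (suc d) r _ d+1≤r r≤2d = 2 * suc d + 2 * (r ∸ suc d) , 3 , s≤s z≤n , construction
  where
  construction : (n : ℕ) → 3 ≤ n → SmallMonotoneDynamo (suc d) n r
    (2 * (r ∸ suc d) * n ^ suc d + r * (2 * suc d + 2 * (r ∸ suc d)) * n ^ d)
  construction (suc m) (s≤s 2≤m) with m≤n⇒m<n∨m≡n r≤2d
  ... | inj₁ r<2d = sparse-monotoneDynamo m 2≤m d+1≤r r<2d
  ... | inj₂ r≡2d = map₂ (map₂ (λ bound → ≤-trans bound (m≤m+n _ _))) (all-active-monotoneDynamo m 2≤m r≡2d)
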